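{- Let $r$, $s$, $c$ and $a_n$ be any integers with $V_r\neq0$, and let $n$ be a positive integer. Then \[ \sum_{a_{n-1}=c}^{a_n}\sum_{a_{n-2}=c}^{a_{n-1}}\cdots\sum_{a_0=c}^{a_1}\frac{(-1)^{a_0}W_{2ra_0+s}}{q^{ra_0}} =(-1)^{a_n}\frac{W_{r(2a_n+n)+s}}{q^{ra_n}V_r^n}+\frac{(-1)^c}{q^{r(c-1)}}\sum_{j=0}^{n-1}\frac{W_{r(n-j+2c-2)+s}}{V_r^{n-j}}\binom{a_n+j-c}{j}. \]
   Context: Let $a,b,p,q$ be complex numbers with $p\neq0$, $q\neq0$. The Horadam sequence $W_j=W_j(a,b;p,q)$ is defined by $W_0=a$, $W_1=b$, $W_j=pW_{j-1}-qW_{j-2}$ for $j\ge2$, and extended to negative indices by $W_{j}=(pW_{j+1}-W_{j+2})/q$, so the recurrence holds for all integers $j$. $V_j=W_j(2,p;p,q)$ is the Lucas sequence of the second kind (same $p,q$). The left side is an iterated sum with $n$ summation signs: $a_{n-1}$ runs from $c$ to $a_n$, and for each $i$ the index $a_{i-1}$ runs from $c$ to $a_i$. Summation convention: for integers $m,M$, $\sum_{k=m}^{M}h(k)$ is the usual sum if $M\ge m$, equals $0$ if $M=m-1$, and equals $-\sum_{k=M+1}^{m-1}h(k)$ if $M\le m-2$. For an integer $N$ and a non-negative integer $j$, $\binom{N}{j}=N(N-1)\cdots(N-j+1)/j!$. -}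

module Defs where

open import Level using (_⊔_) renaming (suc to lsuc)
open import Algebra.Bundles using (CommutativeRing)
open import Data.Nat as ℕ using (ℕ; zero; suc; _!)
open import Data.Nat.Properties using (_!≢0)
open import Data.Integer as ℤ using (ℤ; +_; -[1+_]; ∣_∣; _/ℕ_)
open import Data.Product using (_×_; _,_; proj₁)
open import Relation.Nullary using (¬_)

record Field c ℓ : Set (lsuc (c ⊔ ℓ)) where
  field
    commutativeRing : CommutativeRing c ℓ
  open CommutativeRing commutativeRing public
  field
    0≉1   : ¬ (0# ≈ 1#)
    inv   : (x : Carrier) → ¬ (x ≈ 0#) → Carrier
    inv-r : (x : Carrier) (nz : ¬ (x ≈ 0#)) → x * inv x nz ≈ 1#

-- Generalised binomial coefficient for an integer N and j ∈ ℕ: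
-- N (N-1) ⋯ (N-j+1) / j!  (the division is exact).
fallingℤ : ℤ → ℕ → ℤ
fallingℤ N zero    = + 1
fallingℤ N (suc j) = fallingℤ N j ℤ.* (N ℤ.- + j)

binomℤ : ℤ → ℕ → ℤ
binomℤ N j = _/ℕ_ (fallingℤ N j) (j !) {{j !≢0}}

module FieldOps {c ℓ} (F : Field c ℓ) where
  open Field F

  powℕ : Carrier → ℕ → Carrier
  powℕ x zero    = 1#
  powℕ x (suc n) = x * powℕ x n

  powℤ : (x : Carrier) → ¬ (x ≈ 0#) → ℤ → Carrier
  powℤ x nz (+ n)      = powℕ x n
  powℤ x nz -[1+ n ]   = powℕ (inv x nz) (suc n)

  sign : ℤ → Carrier
  sign k = powℕ (- 1#) ∣ k ∣

  fromℕ : ℕ → Carrier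
  fromℕ zero    = 0#
  fromℕ (suc n) = 1# + fromℕ n

  fromℤ : ℤ → Carrier
  fromℤ (+ n)     = fromℕ n
  fromℤ -[1+ n ]  = - fromℕ (suc n)

  sumℕ : ℕ → (ℕ → Carrier) → Carrier
  sumℕ zero    h = 0#
  sumℕ (suc n) h = sumℕ n h + h n

  -- Σ_{k=m}^{M} h k with the convention:
  --   usual sum if M ≥ m, 0 if M = m-1, - Σ_{k=M+1}^{m-1} h k if M ≤ m-2.
  sumℤ : ℤ → ℤ → (ℤ → Carrier) → Carrier
  sumℤ m M h with M ℤ.- m ℤ.+ + 1
  ... | + k      = sumℕ k (λ i → h (m ℤ.+ + i))
  ... | -[1+ k ] = - sumℕ (suc k) (λ i → h (M ℤ.+ + 1 ℤ.+ + i))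

  module _ (a b p q : Carrier) (qnz : ¬ (q ≈ 0#)) where
    fwd : ℕ → Carrier × Carrier
    fwd zero = a , b
    fwd (suc n) with fwd n
    ... | x , y = y , (p * y - q * x)

    -- (W_{-k} , W_{-k+1})
    bwd : ℕ → Carrier × Carrier
    bwd zero = a , b
    bwd (suc k) with bwd k
    ... | x , y = ((p * x - y) * inv q qnz) , x

    W : ℤ → Carrier
    W (+ n)     = proj₁ (fwd n)
    W -[1+ n ]  = proj₁ (bwd (suc n))

  V : (p q : Carrier) → ¬ (q ≈ 0#) → ℤ → Carrier
  V p q qnz = W (1# + 1#) p p q qnz

  iterSum : ℕ → ℤ → ℤ → (ℤ → Carrier) → Carrier
  iterSum zero    c x f = f x
  iterSum (suc k) c x f = sumℤ c x (λ y → iterSum k c y f)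

-- Let T n x be the right-hand side with aₙ replaced by x.  Then T 0 is
-- the summand, T (n+1) y − T (n+1) (y−1) = T n y and T (n+1) (c−1) = 0, so every summation
-- sign telescopes: Σ_{y=c}^{x} T n y = T (n+1) x, for all x thanks to the sign convention
-- for reversed ranges.  In the leading term the difference collapses by the Horadam
-- identity W_{m+r} + q^r W_{m−r} = V_r W_m, which holds because both sides solve the
-- recurrence in r with the same two initial values; in the binomial sum it collapses by
-- Pascal's rule for the generalised binomial coefficients.  At x = c−1 only the j = 0
-- binomial coefficient is nonzero, and that term cancels the leading one.

module Submission where

open import Defs
open import Data.Nat as ℕ using (ℕ; zero; suc; _≤_; _!)
open import Data.Nat.Properties using (_!≢0)
import Data.Nat.Properties as ℕP
import Data.Nat.DivMod as ℕD
open import Data.Integer as ℤ using (ℤ; +_; -[1+_]; _⊖_)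
import Data.Integer.Properties as ℤP
open import Data.Integer.Tactic.RingSolver using (solve-∀)
open import Data.Maybe.Base using (Maybe; just; nothing)
open import Data.Product using (∃; _×_; _,_; proj₁)
open import Relation.Binary.PropositionalEquality as ≡ using (_≡_)
open import Relation.Nullary using (¬_; yes; no)
open import Algebra.Solver.Ring.AlmostCommutativeRing
  using (fromCommutativeRing; _-Raw-AlmostCommutative⟶_)

ℤ-induction : ∀ {ℓ} (P : ℤ → Set ℓ) → P (+ 0) →
              (∀ k → P k → P (k ℤ.+ + 1)) → (∀ k → P (k ℤ.+ + 1) → P k) →
              ∀ k → P k
ℤ-induction P P0 up down (+ zero)     = P0
ℤ-induction P P0 up down (+ suc n)    =
  ≡.subst P (≡.cong +_ (ℕP.+-comm n 1)) (up (+ n) (ℤ-induction P P0 up down (+ n)))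
ℤ-induction P P0 up down -[1+ zero ]  = down -[1+ 0 ] P0
ℤ-induction P P0 up down -[1+ suc n ] = down -[1+ suc n ] (ℤ-induction P P0 up down -[1+ n ])

module GeneralisedBinomial where

  open ≡ using (refl; cong; sym; trans)
  open ≡.≡-Reasoning

  fallingℤ-zero : ∀ j → fallingℤ (+ 0) (suc j) ≡ + 0
  fallingℤ-zero zero    = refl
  fallingℤ-zero (suc j) = cong (ℤ._* (+ 0 ℤ.- + suc j)) (fallingℤ-zero j)

  fallingℤ-shift : ∀ N j → fallingℤ (N ℤ.+ + 1) (suc j) ≡ (N ℤ.+ + 1) ℤ.* fallingℤ N j
  fallingℤ-shift N zero    = base N
    where
    base : ∀ N → + 1 ℤ.* (N ℤ.+ + 1 ℤ.- + 0) ≡ (N ℤ.+ + 1) ℤ.* + 1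
    base = solve-∀
  fallingℤ-shift N (suc j) = begin
    fallingℤ (N ℤ.+ + 1) (suc j) ℤ.* (N ℤ.+ + 1 ℤ.- + suc j)     ≡⟨ cong (ℤ._* (N ℤ.+ + 1 ℤ.- + suc j)) (fallingℤ-shift N j) ⟩
    (N ℤ.+ + 1) ℤ.* fallingℤ N j ℤ.* (N ℤ.+ + 1 ℤ.- + suc j)     ≡⟨ step N (fallingℤ N j) (+ j) ⟩
    (N ℤ.+ + 1) ℤ.* (fallingℤ N j ℤ.* (N ℤ.- + j))               ∎
    where
    step : ∀ N f J → (N ℤ.+ + 1) ℤ.* f ℤ.* (N ℤ.+ + 1 ℤ.- (+ 1 ℤ.+ J)) ≡ (N ℤ.+ + 1) ℤ.* (f ℤ.* (N ℤ.- J))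
    step = solve-∀

  fallingℤ-pascal : ∀ N j → fallingℤ (N ℤ.+ + 1) (suc j) ≡ fallingℤ N (suc j) ℤ.+ + suc j ℤ.* fallingℤ N j
  fallingℤ-pascal N j = trans (fallingℤ-shift N j) (split N (fallingℤ N j) (+ j))
    where
    split : ∀ N f J → (N ℤ.+ + 1) ℤ.* f ≡ f ℤ.* (N ℤ.- J) ℤ.+ (+ 1 ℤ.+ J) ℤ.* f
    split = solve-∀

  fallingℤ-pascal′ : ∀ N j k → fallingℤ N j ≡ k ℤ.* + (j !) →
    fallingℤ (N ℤ.+ + 1) (suc j) ≡ fallingℤ N (suc j) ℤ.+ k ℤ.* + (suc j !)
  fallingℤ-pascal′ N j k eq = begin
    fallingℤ (N ℤ.+ + 1) (suc j)                             ≡⟨ fallingℤ-pascal N j ⟩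
    fallingℤ N (suc j) ℤ.+ + suc j ℤ.* fallingℤ N j          ≡⟨ cong (λ x → fallingℤ N (suc j) ℤ.+ + suc j ℤ.* x) eq ⟩
    fallingℤ N (suc j) ℤ.+ + suc j ℤ.* (k ℤ.* + (j !))       ≡⟨ cong (λ x → fallingℤ N (suc j) ℤ.+ x) (swap (+ suc j) k (+ (j !))) ⟩
    fallingℤ N (suc j) ℤ.+ k ℤ.* (+ suc j ℤ.* + (j !))       ≡⟨ cong (λ x → fallingℤ N (suc j) ℤ.+ k ℤ.* x) (ℤP.pos-* (suc j) (j !)) ⟨
    fallingℤ N (suc j) ℤ.+ k ℤ.* + (suc j !)                 ∎
    where
    swap : ∀ a k f → a ℤ.* (k ℤ.* f) ≡ k ℤ.* (a ℤ.* f)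
    swap = solve-∀

  fallingℤ-pascal″ : ∀ N j k l → fallingℤ N (suc j) ≡ k ℤ.* + (suc j !) → fallingℤ N j ≡ l ℤ.* + (j !) →
    fallingℤ (N ℤ.+ + 1) (suc j) ≡ (k ℤ.+ l) ℤ.* + (suc j !)
  fallingℤ-pascal″ N j k l eqᵏ eqˡ = begin
    fallingℤ (N ℤ.+ + 1) (suc j)                  ≡⟨ fallingℤ-pascal′ N j l eqˡ ⟩
    fallingℤ N (suc j) ℤ.+ l ℤ.* + (suc j !)      ≡⟨ cong (ℤ._+ l ℤ.* + (suc j !)) eqᵏ ⟩
    k ℤ.* + (suc j !) ℤ.+ l ℤ.* + (suc j !)       ≡⟨ ℤP.*-distribʳ-+ (+ (suc j !)) k l ⟨
    (k ℤ.+ l) ℤ.* + (suc j !)                     ∎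

  fallingℤ-divisible : ∀ j N → ∃ λ k → fallingℤ N j ≡ k ℤ.* + (j !)
  fallingℤ-divisible zero    N = + 1 , refl
  fallingℤ-divisible (suc j)   = ℤ-induction _ (+ 0 , fallingℤ-zero j) up down
    where
    up : ∀ N → ∃ (λ k → fallingℤ N (suc j) ≡ k ℤ.* + (suc j !)) →
         ∃ (λ k → fallingℤ (N ℤ.+ + 1) (suc j) ≡ k ℤ.* + (suc j !))
    up N (k , eq) with fallingℤ-divisible j N
    ... | l , eqˡ = k ℤ.+ l , fallingℤ-pascal″ N j k l eq eqˡ
    down : ∀ N → ∃ (λ k → fallingℤ (N ℤ.+ + 1) (suc j) ≡ k ℤ.* + (suc j !)) →
           ∃ (λ k → fallingℤ N (suc j) ≡ k ℤ.* + (suc j !))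
    down N (k , eq) with fallingℤ-divisible j N
    ... | l , eqˡ = k ℤ.- l , (begin
      fallingℤ N (suc j)
        ≡⟨ cancel (fallingℤ N (suc j)) (l ℤ.* + (suc j !)) ⟩
      fallingℤ N (suc j) ℤ.+ l ℤ.* + (suc j !) ℤ.- l ℤ.* + (suc j !)
        ≡⟨ cong (ℤ._- l ℤ.* + (suc j !)) (trans (sym (fallingℤ-pascal′ N j l eqˡ)) eq) ⟩
      k ℤ.* + (suc j !) ℤ.- l ℤ.* + (suc j !)
        ≡⟨ factor k l (+ (suc j !)) ⟩
      (k ℤ.- l) ℤ.* + (suc j !) ∎)
      where
      cancel : ∀ x y → x ≡ x ℤ.+ y ℤ.- y
      cancel = solve-∀
      factor : ∀ k l d → k ℤ.* d ℤ.- l ℤ.* d ≡ (k ℤ.- l) ℤ.* d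
      factor = solve-∀

  i*n/ℕn≡i : ∀ i n .{{_ : ℕ.NonZero n}} → (i ℤ.* + n) ℤ./ℕ n ≡ i
  i*n/ℕn≡i (+ m) n = begin
    (+ m ℤ.* + n) ℤ./ℕ n   ≡⟨ cong (ℤ._/ℕ n) (ℤP.pos-* m n) ⟨
    + (m ℕ.* n ℕ./ n)      ≡⟨ cong +_ (ℕD.m*n/n≡m m n) ⟩
    + m                    ∎
  i*n/ℕn≡i -[1+ m ] n@(suc n-1) = begin
    (-[1+ m ] ℤ.* + n) ℤ./ℕ n          ≡⟨ cong (ℤ._/ℕ n) (ℤP.neg-distribˡ-* (+ suc m) (+ n)) ⟨
    (ℤ.- (+ suc m ℤ.* + n)) ℤ./ℕ n     ≡⟨ cong (λ x → (ℤ.- x) ℤ./ℕ n) (ℤP.pos-* (suc m) n) ⟨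
    -[1+ n-1 ℕ.+ m ℕ.* n ] ℤ./ℕ n      ≡⟨ exact (n-1 ℕ.+ m ℕ.* n) (ℕD.m*n%n≡0 (suc m) n) ⟩
    ℤ.- (+ (suc m ℕ.* n ℕ./ n))        ≡⟨ cong (λ x → ℤ.- (+ x)) (ℕD.m*n/n≡m (suc m) n) ⟩
    -[1+ m ]                           ∎
    where
    exact : ∀ x → suc x ℕ.% n ≡ 0 → -[1+ x ] ℤ./ℕ n ≡ ℤ.- (+ (suc x ℕ./ n))
    exact x eq with suc x ℕ.% n | eq
    ... | zero | _ = refl

  binomℤ-exact : ∀ N j k → fallingℤ N j ≡ k ℤ.* + (j !) → binomℤ N j ≡ k
  binomℤ-exact N j k eq = trans (cong (λ x → ℤ._/ℕ_ x (j !) {{j !≢0}}) eq) (i*n/ℕn≡i k (j !) {{j !≢0}})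

  binomℤ-pascal : ∀ N j → binomℤ (N ℤ.+ + 1) (suc j) ≡ binomℤ N (suc j) ℤ.+ binomℤ N j
  binomℤ-pascal N j with fallingℤ-divisible (suc j) N | fallingℤ-divisible j N
  ... | k , eqᵏ | l , eqˡ
    rewrite binomℤ-exact N (suc j) k eqᵏ | binomℤ-exact N j l eqˡ =
    binomℤ-exact (N ℤ.+ + 1) (suc j) (k ℤ.+ l) (fallingℤ-pascal″ N j k l eqᵏ eqˡ)

  binomℤ-vanishes : ∀ j → binomℤ (+ j) (suc j) ≡ + 0
  binomℤ-vanishes j = binomℤ-exact (+ j) (suc j) (+ 0) (begin
    fallingℤ (+ j) j ℤ.* (+ j ℤ.- + j)   ≡⟨ cong (fallingℤ (+ j) j ℤ.*_) (ℤP.+-inverseʳ (+ j)) ⟩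
    fallingℤ (+ j) j ℤ.* + 0             ≡⟨ ℤP.*-zeroʳ (fallingℤ (+ j) j) ⟩
    + 0                                  ∎)

open GeneralisedBinomial

module _ {ℓ₁ ℓ₂} (F : Field ℓ₁ ℓ₂) where
  open Field F
  open FieldOps F
  open import Algebra.Properties.Ring ring
    using (-‿+-comm; -‿involutive; -‿distribˡ-*; -0#≈0#; -1*x≈-x)
  open import Algebra.Properties.CommutativeSemigroup +-commutativeSemigroup using (interchange)
  open import Relation.Binary.Reasoning.Setoid setoid

  cong≈ : ∀ {i j} (h : ℤ → Carrier) → i ≡ j → h i ≈ h j
  cong≈ h eq = reflexive (≡.cong h eq)

  fromℕ-homo-+ : ∀ m n → fromℕ (m ℕ.+ n) ≈ fromℕ m + fromℕ n
  fromℕ-homo-+ zero    n = sym (+-identityˡ _)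
  fromℕ-homo-+ (suc m) n = trans (+-congˡ (fromℕ-homo-+ m n)) (sym (+-assoc _ _ _))

  fromℤ-⊖ : ∀ m n → fromℤ (m ⊖ n) ≈ fromℕ m - fromℕ n
  fromℤ-⊖ m       zero    = begin
    fromℕ m         ≈⟨ +-identityʳ _ ⟨
    fromℕ m + 0#    ≈⟨ +-congˡ -0#≈0# ⟨
    fromℕ m - 0#    ∎
  fromℤ-⊖ zero    (suc n) = sym (+-identityˡ _)
  fromℤ-⊖ (suc m) (suc n) = begin
    fromℤ (suc m ⊖ suc n)                ≡⟨ ≡.cong fromℤ (ℤP.[1+m]⊖[1+n]≡m⊖n m n) ⟩
    fromℤ (m ⊖ n)                        ≈⟨ fromℤ-⊖ m n ⟩
    x - y                                ≈⟨ +-identityˡ _ ⟨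
    0# + (x - y)                         ≈⟨ +-congʳ (-‿inverseʳ 1#) ⟨
    (1# - 1#) + (x - y)                  ≈⟨ interchange 1# x (- 1#) (- y) ⟨
    (1# + x) + (- 1# - y)                ≈⟨ +-congˡ (-‿+-comm 1# y) ⟩
    (1# + x) - (1# + y)                  ∎
    where
    x y : Carrier
    x = fromℕ m
    y = fromℕ n

  fromℤ-homo-+ : ∀ i j → fromℤ (i ℤ.+ j) ≈ fromℤ i + fromℤ j
  fromℤ-homo-+ (+ m)    (+ n)    = fromℕ-homo-+ m n
  fromℤ-homo-+ (+ m)    -[1+ n ] = fromℤ-⊖ m (suc n)
  fromℤ-homo-+ -[1+ m ] (+ n)    = trans (fromℤ-⊖ n (suc m)) (+-comm _ _)
  fromℤ-homo-+ -[1+ m ] -[1+ n ] = begin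
    - fromℕ (suc (suc (m ℕ.+ n)))         ≡⟨ ≡.cong (λ k → - fromℕ k) (ℕP.+-suc (suc m) n) ⟨
    - fromℕ (suc m ℕ.+ suc n)            ≈⟨ -‿cong (fromℕ-homo-+ (suc m) (suc n)) ⟩
    - (fromℕ (suc m) + fromℕ (suc n))    ≈⟨ -‿+-comm _ _ ⟨
    - fromℕ (suc m) - fromℕ (suc n)      ∎

  fromℤ-homo-neg : ∀ i → fromℤ (ℤ.- i) ≈ - fromℤ i
  fromℤ-homo-neg (+ zero)  = sym -0#≈0#
  fromℤ-homo-neg (+ suc n) = refl
  fromℤ-homo-neg -[1+ n ]  = sym (-‿involutive _)

  fromℤ-homo-*ˡ : ∀ m j → fromℤ (+ m ℤ.* j) ≈ fromℕ m * fromℤ j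
  fromℤ-homo-*ˡ zero    j = sym (zeroˡ _)
  fromℤ-homo-*ˡ (suc m) j = begin
    fromℤ (+ suc m ℤ.* j)                  ≡⟨ ≡.cong fromℤ (ℤP.suc-* (+ m) j) ⟩
    fromℤ (j ℤ.+ + m ℤ.* j)                ≈⟨ fromℤ-homo-+ j (+ m ℤ.* j) ⟩
    fromℤ j + fromℤ (+ m ℤ.* j)            ≈⟨ +-cong (sym (*-identityˡ _)) (fromℤ-homo-*ˡ m j) ⟩
    1# * fromℤ j + fromℕ m * fromℤ j       ≈⟨ distribʳ _ _ _ ⟨
    (1# + fromℕ m) * fromℤ j               ∎

  fromℤ-homo-* : ∀ i j → fromℤ (i ℤ.* j) ≈ fromℤ i * fromℤ j
  fromℤ-homo-* (+ m)    j = fromℤ-homo-*ˡ m j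
  fromℤ-homo-* -[1+ m ] j = begin
    fromℤ (-[1+ m ] ℤ.* j)           ≡⟨ ≡.cong fromℤ (ℤP.neg-distribˡ-* (+ suc m) j) ⟨
    fromℤ (ℤ.- (+ suc m ℤ.* j))      ≈⟨ fromℤ-homo-neg (+ suc m ℤ.* j) ⟩
    - fromℤ (+ suc m ℤ.* j)          ≈⟨ -‿cong (fromℤ-homo-*ˡ (suc m) j) ⟩
    - (fromℕ (suc m) * fromℤ j)      ≈⟨ -‿distribˡ-* _ _ ⟩
    - fromℕ (suc m) * fromℤ j        ∎

  -- The ring solver normalises with integer coefficients, read in the field through fromℤ.
  ℤ⟶Carrier : ℤ.+-*-rawRing -Raw-AlmostCommutative⟶ fromCommutativeRing commutativeRing
  ℤ⟶Carrier = record
    { ⟦_⟧    = fromℤ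
    ; +-homo = fromℤ-homo-+
    ; *-homo = fromℤ-homo-*
    ; -‿homo = fromℤ-homo-neg
    ; 0-homo = refl
    ; 1-homo = +-identityʳ 1#
    }

  fromℤ-≟ : ∀ i j → Maybe (fromℤ i ≈ fromℤ j)
  fromℤ-≟ i j with i ℤ.≟ j
  ... | yes i≡j = just (reflexive (≡.cong fromℤ i≡j))
  ... | no  _   = nothing

  open import Algebra.Solver.Ring ℤ.+-*-rawRing (fromCommutativeRing commutativeRing) ℤ⟶Carrier fromℤ-≟
    using (solve; _:=_; _:+_; _:*_; :-_; _:-_; con)

  fromℤ-binomℤ-pascal : ∀ N j → fromℤ (binomℤ (N ℤ.+ + 1) (suc j)) - fromℤ (binomℤ N (suc j)) ≈ fromℤ (binomℤ N j)
  fromℤ-binomℤ-pascal N j = begin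
    fromℤ (binomℤ (N ℤ.+ + 1) (suc j)) - fromℤ (binomℤ N (suc j))
      ≡⟨ ≡.cong (λ x → fromℤ x - fromℤ (binomℤ N (suc j))) (binomℤ-pascal N j) ⟩
    fromℤ (binomℤ N (suc j) ℤ.+ binomℤ N j) - fromℤ (binomℤ N (suc j))
      ≈⟨ +-congʳ (fromℤ-homo-+ (binomℤ N (suc j)) (binomℤ N j)) ⟩
    fromℤ (binomℤ N (suc j)) + fromℤ (binomℤ N j) - fromℤ (binomℤ N (suc j))
      ≈⟨ solve 2 (λ x y → x :+ y :- x := y) refl _ _ ⟩
    fromℤ (binomℤ N j) ∎

  *-cancelˡ : ∀ x → ¬ (x ≈ 0#) → ∀ {y z} → x * y ≈ x * z → y ≈ z
  *-cancelˡ x x≉0 {y} {z} xy≈xz = begin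
    y                         ≈⟨ *-identityˡ y ⟨
    1# * y                    ≈⟨ *-congʳ x⁻¹x≈1 ⟨
    inv x x≉0 * x * y         ≈⟨ *-assoc _ _ _ ⟩
    inv x x≉0 * (x * y)       ≈⟨ *-congˡ xy≈xz ⟩
    inv x x≉0 * (x * z)       ≈⟨ *-assoc _ _ _ ⟨
    inv x x≉0 * x * z         ≈⟨ *-congʳ x⁻¹x≈1 ⟩
    1# * z                    ≈⟨ *-identityˡ z ⟩
    z                         ∎
    where
    x⁻¹x≈1 : inv x x≉0 * x ≈ 1#
    x⁻¹x≈1 = trans (*-comm _ _) (inv-r x x≉0)

  x[yx⁻¹]≈y : ∀ x (x≉0 : ¬ (x ≈ 0#)) y → x * (y * inv x x≉0) ≈ y
  x[yx⁻¹]≈y x x≉0 y = begin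
    x * (y * inv x x≉0)   ≈⟨ solve 3 (λ x y x⁻¹ → x :* (y :* x⁻¹) := y :* (x :* x⁻¹)) refl x y (inv x x≉0) ⟩
    y * (x * inv x x≉0)   ≈⟨ *-congˡ (inv-r x x≉0) ⟩
    y * 1#                ≈⟨ *-identityʳ y ⟩
    y                     ∎

  sign-pred : ∀ k → sign (k ℤ.- + 1) ≈ - sign k
  sign-pred (+ zero)     = -1*x≈-x 1#
  sign-pred (+ suc n)    = begin
    sign (+ n)                   ≈⟨ -‿involutive _ ⟨
    - (- sign (+ n))             ≈⟨ -‿cong (-1*x≈-x _) ⟨
    - (- 1# * sign (+ n))        ∎
  -- Here k - 1 normalises to -[1+ suc (n + 0) ].
  sign-pred -[1+ n ] rewrite ℕP.+-identityʳ n = -1*x≈-x _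

  module _ (x : Carrier) (x≉0 : ¬ (x ≈ 0#)) where

    powℤ-suc : ∀ k → powℤ x x≉0 (k ℤ.+ + 1) ≈ x * powℤ x x≉0 k
    powℤ-suc (+ n)          = cong≈ (powℤ x x≉0) (≡.cong +_ (ℕP.+-comm n 1))
    powℤ-suc -[1+ zero ]    = sym (trans (*-congˡ (*-identityʳ _)) (inv-r x x≉0))
    powℤ-suc -[1+ suc n ]   = sym (begin
      x * (inv x x≉0 * powℤ x x≉0 -[1+ n ])   ≈⟨ *-assoc _ _ _ ⟨
      x * inv x x≉0 * powℤ x x≉0 -[1+ n ]     ≈⟨ *-congʳ (inv-r x x≉0) ⟩
      1# * powℤ x x≉0 -[1+ n ]                ≈⟨ *-identityˡ _ ⟩
      powℤ x x≉0 -[1+ n ]                     ∎)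

    powℤ-homo-+ : ∀ i j → powℤ x x≉0 (i ℤ.+ j) ≈ powℤ x x≉0 i * powℤ x x≉0 j
    powℤ-homo-+ i = ℤ-induction _ base up down
      where
      xⁱ : Carrier
      xⁱ = powℤ x x≉0 i
      assoc : ∀ i j → i ℤ.+ (j ℤ.+ + 1) ≡ i ℤ.+ j ℤ.+ + 1
      assoc = solve-∀
      base : powℤ x x≉0 (i ℤ.+ + 0) ≈ xⁱ * 1#
      base = trans (cong≈ (powℤ x x≉0) (ℤP.+-identityʳ i)) (sym (*-identityʳ _))
      step : ∀ j → powℤ x x≉0 (i ℤ.+ (j ℤ.+ + 1)) ≈ x * powℤ x x≉0 (i ℤ.+ j)
      step j = trans (cong≈ (powℤ x x≉0) (assoc i j)) (powℤ-suc (i ℤ.+ j))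
      shuffle : ∀ y → x * (xⁱ * y) ≈ xⁱ * (x * y)
      shuffle y = solve 3 (λ x a y → x :* (a :* y) := a :* (x :* y)) refl x xⁱ y
      up : ∀ j → powℤ x x≉0 (i ℤ.+ j) ≈ xⁱ * powℤ x x≉0 j →
           powℤ x x≉0 (i ℤ.+ (j ℤ.+ + 1)) ≈ xⁱ * powℤ x x≉0 (j ℤ.+ + 1)
      up j ih = begin
        powℤ x x≉0 (i ℤ.+ (j ℤ.+ + 1))   ≈⟨ step j ⟩
        x * powℤ x x≉0 (i ℤ.+ j)         ≈⟨ *-congˡ ih ⟩
        x * (xⁱ * powℤ x x≉0 j)          ≈⟨ shuffle _ ⟩
        xⁱ * (x * powℤ x x≉0 j)          ≈⟨ *-congˡ (powℤ-suc j) ⟨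
        xⁱ * powℤ x x≉0 (j ℤ.+ + 1)      ∎
      down : ∀ j → powℤ x x≉0 (i ℤ.+ (j ℤ.+ + 1)) ≈ xⁱ * powℤ x x≉0 (j ℤ.+ + 1) →
             powℤ x x≉0 (i ℤ.+ j) ≈ xⁱ * powℤ x x≉0 j
      down j ih = *-cancelˡ x x≉0 (begin
        x * powℤ x x≉0 (i ℤ.+ j)         ≈⟨ step j ⟨
        powℤ x x≉0 (i ℤ.+ (j ℤ.+ + 1))   ≈⟨ ih ⟩
        xⁱ * powℤ x x≉0 (j ℤ.+ + 1)      ≈⟨ *-congˡ (powℤ-suc j) ⟩
        xⁱ * (x * powℤ x x≉0 j)          ≈⟨ shuffle _ ⟨
        x * (xⁱ * powℤ x x≉0 j)          ∎)

  sumℕ-cong : ∀ n {g h : ℕ → Carrier} → (∀ i → g i ≈ h i) → sumℕ n g ≈ sumℕ n h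
  sumℕ-cong zero    g≈h = refl
  sumℕ-cong (suc n) g≈h = +-cong (sumℕ-cong n g≈h) (g≈h n)

  sumℕ-zero : ∀ n {h : ℕ → Carrier} → (∀ i → h i ≈ 0#) → sumℕ n h ≈ 0#
  sumℕ-zero zero    h≈0 = refl
  sumℕ-zero (suc n) h≈0 = trans (+-cong (sumℕ-zero n h≈0) (h≈0 n)) (+-identityˡ 0#)

  sumℕ-suc : ∀ n (h : ℕ → Carrier) → sumℕ (suc n) h ≈ h 0 + sumℕ n (λ i → h (suc i))
  sumℕ-suc zero    h = +-comm _ _
  sumℕ-suc (suc n) h = trans (+-congʳ (sumℕ-suc n h)) (+-assoc _ _ _)

  sumℕ-difference : ∀ n (g h : ℕ → Carrier) → sumℕ n g - sumℕ n h ≈ sumℕ n (λ i → g i - h i)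
  sumℕ-difference zero    g h = -‿inverseʳ 0#
  sumℕ-difference (suc n) g h = begin
    (sumℕ n g + g n) - (sumℕ n h + h n)      ≈⟨ solve 4 (λ G x H y → (G :+ x) :- (H :+ y) := (G :- H) :+ (x :- y)) refl _ _ _ _ ⟩
    (sumℕ n g - sumℕ n h) + (g n - h n)      ≈⟨ +-congʳ (sumℕ-difference n g h) ⟩
    sumℕ (suc n) (λ i → g i - h i)           ∎

  sumℤ-cong : ∀ m M {g h : ℤ → Carrier} → (∀ y → g y ≈ h y) → sumℤ m M g ≈ sumℤ m M h
  sumℤ-cong m M g≈h with M ℤ.- m ℤ.+ + 1
  ... | + k      = sumℕ-cong k (λ _ → g≈h _)
  ... | -[1+ k ] = -‿cong (sumℕ-cong (suc k) (λ _ → g≈h _))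

  module _ {h T : ℤ → Carrier} (h≈ΔT : ∀ y → h y ≈ T y - T (y ℤ.- + 1)) where

    sumℕ-telescope : ∀ m k → sumℕ k (λ i → h (m ℤ.+ + i)) ≈ T (m ℤ.+ + k ℤ.- + 1) - T (m ℤ.- + 1)
    sumℕ-telescope m zero    = sym (trans (+-congʳ (cong≈ T (empty m))) (-‿inverseʳ _))
      where
      empty : ∀ m → m ℤ.+ + 0 ℤ.- + 1 ≡ m ℤ.- + 1
      empty = solve-∀
    sumℕ-telescope m (suc k) = begin
      sumℕ k (λ i → h (m ℤ.+ + i)) + h (m ℤ.+ + k)                   ≈⟨ +-cong (sumℕ-telescope m k) (h≈ΔT _) ⟩
      (T (m ℤ.+ + k ℤ.- + 1) - T (m ℤ.- + 1)) + (T (m ℤ.+ + k) - T (m ℤ.+ + k ℤ.- + 1))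
                                                                      ≈⟨ solve 3 (λ a b c → (a :- b) :+ (c :- a) := c :- b) refl _ _ _ ⟩
      T (m ℤ.+ + k) - T (m ℤ.- + 1)                                   ≈⟨ +-congʳ (cong≈ T (last m (+ k))) ⟩
      T (m ℤ.+ + suc k ℤ.- + 1) - T (m ℤ.- + 1)                       ∎
      where
      last : ∀ m k → m ℤ.+ k ≡ m ℤ.+ (+ 1 ℤ.+ k) ℤ.- + 1
      last = solve-∀

    sumℤ-telescope : ∀ m M → sumℤ m M h ≈ T M - T (m ℤ.- + 1)
    sumℤ-telescope m M with M ℤ.- m ℤ.+ + 1 in len
    ... | + k      = trans (sumℕ-telescope m k) (+-congʳ (cong≈ T upper))
      where
      upper : m ℤ.+ + k ℤ.- + 1 ≡ M
      upper = ≡.trans (≡.cong (λ k → m ℤ.+ k ℤ.- + 1) (≡.sym len)) (cancel m M)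
        where
        cancel : ∀ m M → m ℤ.+ (M ℤ.- m ℤ.+ + 1) ℤ.- + 1 ≡ M
        cancel = solve-∀
    ... | -[1+ k ] = begin
      - sumℕ (suc k) (λ i → h (M ℤ.+ + 1 ℤ.+ + i))                      ≈⟨ -‿cong (sumℕ-telescope (M ℤ.+ + 1) (suc k)) ⟩
      - (T (M ℤ.+ + 1 ℤ.+ + suc k ℤ.- + 1) - T (M ℤ.+ + 1 ℤ.- + 1))    ≈⟨ -‿cong (+-cong (cong≈ T upper) (-‿cong (cong≈ T (cancel M)))) ⟩
      - (T (m ℤ.- + 1) - T M)                                          ≈⟨ solve 2 (λ a b → :- (a :- b) := b :- a) refl _ _ ⟩
      T M - T (m ℤ.- + 1)                                              ∎
      where
      cancel : ∀ M → M ℤ.+ + 1 ℤ.- + 1 ≡ M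
      cancel = solve-∀
      shift : ∀ M K → M ℤ.+ + 1 ℤ.+ (+ 1 ℤ.+ K) ℤ.- + 1 ≡ M ℤ.- (ℤ.- (+ 1 ℤ.+ K))
      shift = solve-∀
      lower : ∀ M m → M ℤ.- (M ℤ.- m ℤ.+ + 1) ≡ m ℤ.- + 1
      lower = solve-∀
      upper : M ℤ.+ + 1 ℤ.+ + suc k ℤ.- + 1 ≡ m ℤ.- + 1
      upper = ≡.trans (shift M (+ k)) (≡.trans (≡.cong (λ k → M ℤ.- k) (≡.sym len)) (lower M m))

  module _ (p q : Carrier) (q≉0 : ¬ (q ≈ 0#)) where

    Recurrent : (ℤ → Carrier) → Set ℓ₂
    Recurrent h = ∀ k → h (k ℤ.+ + 2) ≈ p * h (k ℤ.+ + 1) - q * h k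

    recurrent-unique : ∀ {g h} → Recurrent g → Recurrent h →
                       g (+ 0) ≈ h (+ 0) → g (+ 1) ≈ h (+ 1) → ∀ k → g k ≈ h k
    recurrent-unique {g} {h} rec-g rec-h g0≈h0 g1≈h1 k =
      proj₁ (ℤ-induction Agree (g0≈h0 , g1≈h1) up down k)
      where
      Agree : ℤ → Set ℓ₂
      Agree k = g k ≈ h k × g (k ℤ.+ + 1) ≈ h (k ℤ.+ + 1)
      two : ∀ k → k ℤ.+ + 1 ℤ.+ + 1 ≡ k ℤ.+ + 2
      two = solve-∀
      back : ∀ {f} → Recurrent f → ∀ k → q * f k ≈ p * f (k ℤ.+ + 1) - f (k ℤ.+ + 2)
      back {f} rec-f k = begin
        q * f k                                        ≈⟨ solve 4 (λ p q x y → q :* x := p :* y :- (p :* y :- q :* x)) refl p q _ _ ⟩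
        p * f (k ℤ.+ + 1) - (p * f (k ℤ.+ + 1) - q * f k) ≈⟨ +-congˡ (-‿cong (rec-f k)) ⟨
        p * f (k ℤ.+ + 1) - f (k ℤ.+ + 2)                ∎
      up : ∀ k → Agree k → Agree (k ℤ.+ + 1)
      up k (eq₀ , eq₁) = eq₁ , (begin
        g (k ℤ.+ + 1 ℤ.+ + 1)                 ≈⟨ cong≈ g (two k) ⟩
        g (k ℤ.+ + 2)                         ≈⟨ rec-g k ⟩
        p * g (k ℤ.+ + 1) - q * g k           ≈⟨ +-cong (*-congˡ eq₁) (-‿cong (*-congˡ eq₀)) ⟩
        p * h (k ℤ.+ + 1) - q * h k           ≈⟨ rec-h k ⟨
        h (k ℤ.+ + 2)                         ≈⟨ cong≈ h (two k) ⟨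
        h (k ℤ.+ + 1 ℤ.+ + 1)                 ∎)
      down : ∀ k → Agree (k ℤ.+ + 1) → Agree k
      down k (eq₁ , eq₂) = *-cancelˡ q q≉0 (begin
        q * g k                               ≈⟨ back rec-g k ⟩
        p * g (k ℤ.+ + 1) - g (k ℤ.+ + 2)     ≈⟨ +-cong (*-congˡ eq₁) (-‿cong eq₂′) ⟩
        p * h (k ℤ.+ + 1) - h (k ℤ.+ + 2)     ≈⟨ back rec-h k ⟨
        q * h k                               ∎) , eq₁
        where
        eq₂′ : g (k ℤ.+ + 2) ≈ h (k ℤ.+ + 2)
        eq₂′ = trans (cong≈ g (≡.sym (two k))) (trans eq₂ (cong≈ h (two k)))

    recurrent-+ : ∀ {g h} → Recurrent g → Recurrent h → Recurrent (λ k → g k + h k)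
    recurrent-+ {g} {h} rec-g rec-h k = begin
      g (k ℤ.+ + 2) + h (k ℤ.+ + 2)
        ≈⟨ +-cong (rec-g k) (rec-h k) ⟩
      (p * g₁ - q * g₀) + (p * h₁ - q * h₀)
        ≈⟨ solve 6 (λ p q g₀ g₁ h₀ h₁ → (p :* g₁ :- q :* g₀) :+ (p :* h₁ :- q :* h₀)
                                        := p :* (g₁ :+ h₁) :- q :* (g₀ :+ h₀))
                   refl p q g₀ g₁ h₀ h₁ ⟩
      p * (g₁ + h₁) - q * (g₀ + h₀) ∎
      where
      g₀ g₁ h₀ h₁ : Carrier
      g₀ = g k
      g₁ = g (k ℤ.+ + 1)
      h₀ = h k
      h₁ = h (k ℤ.+ + 1)

    recurrent-*ʳ : ∀ {h} → Recurrent h → ∀ x → Recurrent (λ k → h k * x)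
    recurrent-*ʳ {h} rec-h x k = begin
      h (k ℤ.+ + 2) * x
        ≈⟨ *-congʳ (rec-h k) ⟩
      (p * h (k ℤ.+ + 1) - q * h k) * x
        ≈⟨ solve 5 (λ p q h₀ h₁ x → (p :* h₁ :- q :* h₀) :* x := p :* (h₁ :* x) :- q :* (h₀ :* x))
                   refl p q (h k) (h (k ℤ.+ + 1)) x ⟩
      p * (h (k ℤ.+ + 1) * x) - q * (h k * x) ∎

    recurrent-shift : ∀ {h} → Recurrent h → ∀ m → Recurrent (λ k → h (m ℤ.+ k))
    recurrent-shift {h} rec-h m k = begin
      h (m ℤ.+ (k ℤ.+ + 2))                              ≈⟨ cong≈ h (assoc m k (+ 2)) ⟩
      h (m ℤ.+ k ℤ.+ + 2)                                ≈⟨ rec-h (m ℤ.+ k) ⟩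
      p * h (m ℤ.+ k ℤ.+ + 1) - q * h (m ℤ.+ k)          ≈⟨ +-congʳ (*-congˡ (cong≈ h (assoc m k (+ 1)))) ⟨
      p * h (m ℤ.+ (k ℤ.+ + 1)) - q * h (m ℤ.+ k)        ∎
      where
      assoc : ∀ m k i → m ℤ.+ (k ℤ.+ i) ≡ m ℤ.+ k ℤ.+ i
      assoc = solve-∀

    recurrent-reflect : ∀ {h} → Recurrent h → ∀ m → Recurrent (λ k → powℤ q q≉0 k * h (m ℤ.- k))
    recurrent-reflect {h} rec-h m k = begin
      qᶻ (k ℤ.+ + 2) * h t
        ≈⟨ *-congʳ (trans (cong≈ qᶻ (two k)) (trans (powℤ-suc q q≉0 (k ℤ.+ + 1)) (*-congˡ (powℤ-suc q q≉0 k)))) ⟩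
      q * (q * qᶻ k) * h t
        ≈⟨ solve 5 (λ p q x h₀ h₁ → q :* (q :* x) :* h₀
                                    := p :* (q :* x :* h₁) :- q :* (x :* (p :* h₁ :- q :* h₀)))
                   refl p q (qᶻ k) (h t) (h (t ℤ.+ + 1)) ⟩
      p * (q * qᶻ k * h (t ℤ.+ + 1)) - q * (qᶻ k * (p * h (t ℤ.+ + 1) - q * h t))
        ≈⟨ +-cong (*-congˡ (*-cong (powℤ-suc q q≉0 k) (cong≈ h (reflect₁ m k))))
                  (-‿cong (*-congˡ (*-congˡ (rec-h t)))) ⟨
      p * (qᶻ (k ℤ.+ + 1) * h (m ℤ.- (k ℤ.+ + 1))) - q * (qᶻ k * h (t ℤ.+ + 2))
        ≈⟨ +-congˡ (-‿cong (*-congˡ (*-congˡ (cong≈ h (reflect₂ m k))))) ⟨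
      p * (qᶻ (k ℤ.+ + 1) * h (m ℤ.- (k ℤ.+ + 1))) - q * (qᶻ k * h (m ℤ.- k)) ∎
      where
      qᶻ : ℤ → Carrier
      qᶻ = powℤ q q≉0
      t : ℤ
      t = m ℤ.- (k ℤ.+ + 2)
      two : ∀ k → k ℤ.+ + 2 ≡ k ℤ.+ + 1 ℤ.+ + 1
      two = solve-∀
      reflect₁ : ∀ m k → m ℤ.- (k ℤ.+ + 1) ≡ m ℤ.- (k ℤ.+ + 2) ℤ.+ + 1
      reflect₁ = solve-∀
      reflect₂ : ∀ m k → m ℤ.- k ≡ m ℤ.- (k ℤ.+ + 2) ℤ.+ + 2
      reflect₂ = solve-∀

    -- The recurrence at the negative indices, where W is defined by running it backwards.
    recurrence-backward : ∀ x y → x ≈ p * y - q * ((p * y - x) * inv q q≉0)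
    recurrence-backward x y = begin
      x                                        ≈⟨ solve 3 (λ p x y → x := p :* y :- (p :* y :- x)) refl p x y ⟩
      p * y - (p * y - x)                      ≈⟨ +-congˡ (-‿cong (x[yx⁻¹]≈y q q≉0 _)) ⟨
      p * y - q * ((p * y - x) * inv q q≉0)    ∎

    W-recurrent : ∀ a b → Recurrent (W a b p q q≉0)
    W-recurrent a b (+ n)              = begin
      Wₐ (+ n ℤ.+ + 2)                       ≈⟨ cong≈ Wₐ (≡.cong +_ (ℕP.+-comm n 2)) ⟩
      p * Wₐ (+ suc n) - q * Wₐ (+ n)        ≈⟨ +-congʳ (*-congˡ (cong≈ Wₐ (≡.cong +_ (ℕP.+-comm 1 n)))) ⟩
      p * Wₐ (+ n ℤ.+ + 1) - q * Wₐ (+ n)    ∎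
      where
      Wₐ : ℤ → Carrier
      Wₐ = W a b p q q≉0
    W-recurrent a b -[1+ zero ]        = recurrence-backward b a
    W-recurrent a b -[1+ suc zero ]    = recurrence-backward a (W a b p q q≉0 -[1+ 0 ])
    W-recurrent a b -[1+ suc (suc m) ] = recurrence-backward (W a b p q q≉0 -[1+ m ]) (W a b p q q≉0 -[1+ suc m ])

    W[m+r]+qʳW[m-r]≈VᵣWₘ : ∀ a b m r →
      W a b p q q≉0 (m ℤ.+ r) + powℤ q q≉0 r * W a b p q q≉0 (m ℤ.- r) ≈ V p q q≉0 r * W a b p q q≉0 m
    W[m+r]+qʳW[m-r]≈VᵣWₘ a b m = recurrent-unique
      (recurrent-+ (recurrent-shift (W-recurrent a b) m) (recurrent-reflect (W-recurrent a b) m))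
      (recurrent-*ʳ (W-recurrent (1# + 1#) p) (Wₐ m))
      at-0 at-1
      where
      Wₐ : ℤ → Carrier
      Wₐ = W a b p q q≉0
      plus-0 : ∀ m → m ℤ.+ + 0 ≡ m
      plus-0 = solve-∀
      minus-0 : ∀ m → m ℤ.- + 0 ≡ m
      minus-0 = solve-∀
      plus-1 : ∀ m → m ℤ.+ + 1 ≡ m ℤ.- + 1 ℤ.+ + 2
      plus-1 = solve-∀
      minus-1 : ∀ m → m ℤ.- + 1 ℤ.+ + 1 ≡ m
      minus-1 = solve-∀
      at-0 : Wₐ (m ℤ.+ + 0) + 1# * Wₐ (m ℤ.- + 0) ≈ (1# + 1#) * Wₐ m
      at-0 = begin
        Wₐ (m ℤ.+ + 0) + 1# * Wₐ (m ℤ.- + 0)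
          ≈⟨ +-cong (trans (cong≈ Wₐ (plus-0 m)) (sym (*-identityˡ _))) (*-congˡ (cong≈ Wₐ (minus-0 m))) ⟩
        1# * Wₐ m + 1# * Wₐ m
          ≈⟨ distribʳ _ _ _ ⟨
        (1# + 1#) * Wₐ m ∎
      at-1 : Wₐ (m ℤ.+ + 1) + q * 1# * Wₐ (m ℤ.- + 1) ≈ p * Wₐ m
      at-1 = begin
        Wₐ (m ℤ.+ + 1) + q * 1# * Wₐ (m ℤ.- + 1)
          ≈⟨ +-cong (trans (cong≈ Wₐ (plus-1 m)) (W-recurrent a b (m ℤ.- + 1))) (*-congʳ (*-identityʳ q)) ⟩
        p * Wₐ (m ℤ.- + 1 ℤ.+ + 1) - q * Wₐ (m ℤ.- + 1) + q * Wₐ (m ℤ.- + 1)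
          ≈⟨ solve 4 (λ p q y x → p :* y :- q :* x :+ q :* x := p :* y) refl p q _ _ ⟩
        p * Wₐ (m ℤ.- + 1 ℤ.+ + 1)
          ≈⟨ *-congˡ (cong≈ Wₐ (minus-1 m)) ⟩
        p * Wₐ m ∎

  module _ (a b p q : Carrier) (q≉0 : ¬ (q ≈ 0#)) (r s c : ℤ) (Vᵣ≉0 : ¬ (V p q q≉0 r ≈ 0#)) where

    private
      Wₐ : ℤ → Carrier
      Wₐ = W a b p q q≉0
      qᶻ : ℤ → Carrier
      qᶻ = powℤ q q≉0
      Vᵣ : Carrier
      Vᵣ = V p q q≉0 r
      Vᵣ⁻¹ : Carrier
      Vᵣ⁻¹ = inv Vᵣ Vᵣ≉0

    summand : ℤ → Carrier
    summand x = sign x * Wₐ (+ 2 ℤ.* r ℤ.* x ℤ.+ s) * qᶻ (ℤ.- (r ℤ.* x))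

    leading : ℕ → ℤ → Carrier
    leading n x = sign x * Wₐ (r ℤ.* (+ 2 ℤ.* x ℤ.+ + n) ℤ.+ s) * qᶻ (ℤ.- (r ℤ.* x)) * powℕ Vᵣ⁻¹ n

    binomialTerm : ℕ → ℤ → ℕ → Carrier
    binomialTerm n x j = Wₐ (r ℤ.* (+ n ℤ.- + j ℤ.+ + 2 ℤ.* c ℤ.- + 2) ℤ.+ s) * powℕ Vᵣ⁻¹ (n ℕ.∸ j)
                         * fromℤ (binomℤ (x ℤ.+ + j ℤ.- c) j)

    closedForm : ℕ → ℤ → Carrier
    closedForm n x = leading n x + sign c * qᶻ (ℤ.- (r ℤ.* (c ℤ.- + 1))) * sumℕ n (binomialTerm n x)

    leading-difference : ∀ n y → leading (suc n) y - leading (suc n) (y ℤ.- + 1) ≈ leading n y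
    leading-difference n y = begin
      leading (suc n) y - leading (suc n) (y ℤ.- + 1)
        ≈⟨ +-cong (*-congʳ (*-congʳ (*-congˡ (cong≈ Wₐ (index-up r y (+ n) s)))))
                  (-‿cong (*-congʳ (*-cong (*-cong (sign-pred y) (cong≈ Wₐ (index-down r y (+ n) s))) qᶻ-shift))) ⟩
      σ * Wₐ (m ℤ.+ r) * τ * (Vᵣ⁻¹ * Vⁿ) - (- σ) * Wₐ (m ℤ.- r) * (τ * qᶻ r) * (Vᵣ⁻¹ * Vⁿ)
        ≈⟨ solve 7 (λ σ A B τ Q V⁻¹ Vⁿ → σ :* A :* τ :* (V⁻¹ :* Vⁿ) :- (:- σ) :* B :* (τ :* Q) :* (V⁻¹ :* Vⁿ)
                                          := σ :* τ :* V⁻¹ :* Vⁿ :* (A :+ Q :* B))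
                   refl σ (Wₐ (m ℤ.+ r)) (Wₐ (m ℤ.- r)) τ (qᶻ r) Vᵣ⁻¹ Vⁿ ⟩
      σ * τ * Vᵣ⁻¹ * Vⁿ * (Wₐ (m ℤ.+ r) + qᶻ r * Wₐ (m ℤ.- r))
        ≈⟨ *-congˡ (W[m+r]+qʳW[m-r]≈VᵣWₘ p q q≉0 a b m r) ⟩
      σ * τ * Vᵣ⁻¹ * Vⁿ * (Vᵣ * Wₐ m)
        ≈⟨ solve 6 (λ σ τ V⁻¹ Vⁿ V w → σ :* τ :* V⁻¹ :* Vⁿ :* (V :* w) := σ :* w :* τ :* Vⁿ :* (V :* V⁻¹))
                   refl σ τ Vᵣ⁻¹ Vⁿ Vᵣ (Wₐ m) ⟩
      σ * Wₐ m * τ * Vⁿ * (Vᵣ * Vᵣ⁻¹)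
        ≈⟨ *-congˡ (inv-r Vᵣ Vᵣ≉0) ⟩
      σ * Wₐ m * τ * Vⁿ * 1#
        ≈⟨ *-identityʳ _ ⟩
      leading n y ∎
      where
      σ τ Vⁿ : Carrier
      σ = sign y
      τ = qᶻ (ℤ.- (r ℤ.* y))
      Vⁿ = powℕ Vᵣ⁻¹ n
      m : ℤ
      m = r ℤ.* (+ 2 ℤ.* y ℤ.+ + n) ℤ.+ s
      index-up : ∀ r y N s → r ℤ.* (+ 2 ℤ.* y ℤ.+ (+ 1 ℤ.+ N)) ℤ.+ s ≡ r ℤ.* (+ 2 ℤ.* y ℤ.+ N) ℤ.+ s ℤ.+ r
      index-up = solve-∀
      index-down : ∀ r y N s → r ℤ.* (+ 2 ℤ.* (y ℤ.- + 1) ℤ.+ (+ 1 ℤ.+ N)) ℤ.+ s ≡ r ℤ.* (+ 2 ℤ.* y ℤ.+ N) ℤ.+ s ℤ.- r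
      index-down = solve-∀
      exponent : ∀ r y → ℤ.- (r ℤ.* (y ℤ.- + 1)) ≡ ℤ.- (r ℤ.* y) ℤ.+ r
      exponent = solve-∀
      qᶻ-shift : qᶻ (ℤ.- (r ℤ.* (y ℤ.- + 1))) ≈ τ * qᶻ r
      qᶻ-shift = trans (cong≈ qᶻ (exponent r y)) (powℤ-homo-+ q q≉0 (ℤ.- (r ℤ.* y)) r)

    binomialTerm-difference : ∀ n y j →
      binomialTerm (suc n) y (suc j) - binomialTerm (suc n) (y ℤ.- + 1) (suc j) ≈ binomialTerm n y j
    binomialTerm-difference n y j = begin
      w * v * fromℤ (binomℤ (y ℤ.+ + suc j ℤ.- c) (suc j)) - w * v * fromℤ (binomℤ N (suc j))
        ≈⟨ solve 4 (λ w v x x′ → w :* v :* x :- w :* v :* x′ := w :* v :* (x :- x′)) refl w v _ _ ⟩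
      w * v * (fromℤ (binomℤ (y ℤ.+ + suc j ℤ.- c) (suc j)) - fromℤ (binomℤ N (suc j)))
        ≈⟨ *-congˡ (+-congʳ (cong≈ (λ x → fromℤ (binomℤ x (suc j))) (upper y (+ j) c))) ⟩
      w * v * (fromℤ (binomℤ (N ℤ.+ + 1) (suc j)) - fromℤ (binomℤ N (suc j)))
        ≈⟨ *-cong (*-congʳ (cong≈ Wₐ (index r (+ n) (+ j) c s))) (fromℤ-binomℤ-pascal N j) ⟩
      Wₐ (r ℤ.* (+ n ℤ.- + j ℤ.+ + 2 ℤ.* c ℤ.- + 2) ℤ.+ s) * v * fromℤ (binomℤ N j)
        ≈⟨ *-congˡ (cong≈ (λ x → fromℤ (binomℤ x j)) (lower y (+ j) c)) ⟩
      binomialTerm n y j ∎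
      where
      w v : Carrier
      w = Wₐ (r ℤ.* (+ suc n ℤ.- + suc j ℤ.+ + 2 ℤ.* c ℤ.- + 2) ℤ.+ s)
      v = powℕ Vᵣ⁻¹ (n ℕ.∸ j)
      N : ℤ
      N = y ℤ.- + 1 ℤ.+ + suc j ℤ.- c
      upper : ∀ y J c → y ℤ.+ (+ 1 ℤ.+ J) ℤ.- c ≡ y ℤ.- + 1 ℤ.+ (+ 1 ℤ.+ J) ℤ.- c ℤ.+ + 1
      upper = solve-∀
      lower : ∀ y J c → y ℤ.- + 1 ℤ.+ (+ 1 ℤ.+ J) ℤ.- c ≡ y ℤ.+ J ℤ.- c
      lower = solve-∀
      index : ∀ r N J c s → r ℤ.* (+ 1 ℤ.+ N ℤ.- (+ 1 ℤ.+ J) ℤ.+ + 2 ℤ.* c ℤ.- + 2) ℤ.+ s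
                          ≡ r ℤ.* (N ℤ.- J ℤ.+ + 2 ℤ.* c ℤ.- + 2) ℤ.+ s
      index = solve-∀

    binomialSum-difference : ∀ n y →
      sumℕ (suc n) (binomialTerm (suc n) y) - sumℕ (suc n) (binomialTerm (suc n) (y ℤ.- + 1)) ≈ sumℕ n (binomialTerm n y)
    binomialSum-difference n y = begin
      sumℕ (suc n) (binomialTerm (suc n) y) - sumℕ (suc n) (binomialTerm (suc n) (y ℤ.- + 1))
        ≈⟨ sumℕ-difference (suc n) _ _ ⟩
      sumℕ (suc n) Δ
        ≈⟨ sumℕ-suc n Δ ⟩
      Δ 0 + sumℕ n (λ j → Δ (suc j))
        ≈⟨ +-cong (-‿inverseʳ _) (sumℕ-cong n (binomialTerm-difference n y)) ⟩
      0# + sumℕ n (binomialTerm n y)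
        ≈⟨ +-identityˡ _ ⟩
      sumℕ n (binomialTerm n y) ∎
      where
      Δ : ℕ → Carrier
      Δ j = binomialTerm (suc n) y j - binomialTerm (suc n) (y ℤ.- + 1) j

    closedForm-difference : ∀ n y → closedForm (suc n) y - closedForm (suc n) (y ℤ.- + 1) ≈ closedForm n y
    closedForm-difference n y = begin
      closedForm (suc n) y - closedForm (suc n) (y ℤ.- + 1)
        ≈⟨ solve 5 (λ g g′ k x x′ → g :+ k :* x :- (g′ :+ k :* x′) := g :- g′ :+ k :* (x :- x′)) refl _ _ κ _ _ ⟩
      leading (suc n) y - leading (suc n) (y ℤ.- + 1)
        + κ * (sumℕ (suc n) (binomialTerm (suc n) y) - sumℕ (suc n) (binomialTerm (suc n) (y ℤ.- + 1)))
        ≈⟨ +-cong (leading-difference n y) (*-congˡ (binomialSum-difference n y)) ⟩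
      closedForm n y ∎
      where
      κ : Carrier
      κ = sign c * qᶻ (ℤ.- (r ℤ.* (c ℤ.- + 1)))

    binomialSum-at-pred : ∀ n →
      sumℕ (suc n) (binomialTerm (suc n) (c ℤ.- + 1))
        ≈ Wₐ (r ℤ.* (+ suc n ℤ.- + 0 ℤ.+ + 2 ℤ.* c ℤ.- + 2) ℤ.+ s) * powℕ Vᵣ⁻¹ (suc n)
    binomialSum-at-pred n = begin
      sumℕ (suc n) (binomialTerm (suc n) (c ℤ.- + 1))
        ≈⟨ sumℕ-suc n _ ⟩
      binomialTerm (suc n) (c ℤ.- + 1) 0 + sumℕ n (λ j → binomialTerm (suc n) (c ℤ.- + 1) (suc j))
        ≈⟨ +-congˡ (sumℕ-zero n vanishes) ⟩
      binomialTerm (suc n) (c ℤ.- + 1) 0 + 0#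
        ≈⟨ +-identityʳ _ ⟩
      w * powℕ Vᵣ⁻¹ (suc n) * (1# + 0#)
        ≈⟨ *-congˡ (+-identityʳ 1#) ⟩
      w * powℕ Vᵣ⁻¹ (suc n) * 1#
        ≈⟨ *-identityʳ _ ⟩
      w * powℕ Vᵣ⁻¹ (suc n) ∎
      where
      w : Carrier
      w = Wₐ (r ℤ.* (+ suc n ℤ.- + 0 ℤ.+ + 2 ℤ.* c ℤ.- + 2) ℤ.+ s)
      top : ∀ c J → c ℤ.- + 1 ℤ.+ (+ 1 ℤ.+ J) ℤ.- c ≡ J
      top = solve-∀
      vanishes : ∀ j → binomialTerm (suc n) (c ℤ.- + 1) (suc j) ≈ 0#
      vanishes j = trans (*-congˡ (trans (cong≈ (λ x → fromℤ (binomℤ x (suc j))) (top c (+ j)))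
                                          (cong≈ fromℤ (binomℤ-vanishes j))))
                         (zeroʳ _)

    closedForm-at-pred : ∀ n → closedForm (suc n) (c ℤ.- + 1) ≈ 0#
    closedForm-at-pred n = begin
      closedForm (suc n) (c ℤ.- + 1)
        ≈⟨ +-cong (*-congʳ (*-congʳ (*-cong (sign-pred c) (cong≈ Wₐ (index r c (+ n) s))))) (*-congˡ (binomialSum-at-pred n)) ⟩
      (- sign c) * w * τ * Vⁿ⁺¹ + sign c * τ * (w * Vⁿ⁺¹)
        ≈⟨ solve 4 (λ σ w τ V → (:- σ) :* w :* τ :* V :+ σ :* τ :* (w :* V) := con (+ 0)) refl (sign c) w τ Vⁿ⁺¹ ⟩
      0# ∎
      where
      w τ Vⁿ⁺¹ : Carrier
      w = Wₐ (r ℤ.* (+ suc n ℤ.- + 0 ℤ.+ + 2 ℤ.* c ℤ.- + 2) ℤ.+ s)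
      τ = qᶻ (ℤ.- (r ℤ.* (c ℤ.- + 1)))
      Vⁿ⁺¹ = powℕ Vᵣ⁻¹ (suc n)
      index : ∀ r c N s → r ℤ.* (+ 2 ℤ.* (c ℤ.- + 1) ℤ.+ (+ 1 ℤ.+ N)) ℤ.+ s
                        ≡ r ℤ.* (+ 1 ℤ.+ N ℤ.- + 0 ℤ.+ + 2 ℤ.* c ℤ.- + 2) ℤ.+ s
      index = solve-∀

    summand≈closedForm-0 : ∀ x → summand x ≈ closedForm 0 x
    summand≈closedForm-0 x = begin
      sign x * Wₐ (+ 2 ℤ.* r ℤ.* x ℤ.+ s) * qᶻ (ℤ.- (r ℤ.* x))            ≈⟨ *-congʳ (*-congˡ (cong≈ Wₐ (index r x s))) ⟩
      sign x * Wₐ (r ℤ.* (+ 2 ℤ.* x ℤ.+ + 0) ℤ.+ s) * qᶻ (ℤ.- (r ℤ.* x))   ≈⟨ *-identityʳ _ ⟨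
      leading 0 x                                                          ≈⟨ +-identityʳ _ ⟨
      leading 0 x + 0#                                                     ≈⟨ +-congˡ (zeroʳ _) ⟨
      closedForm 0 x                                                       ∎
      where
      index : ∀ r x s → + 2 ℤ.* r ℤ.* x ℤ.+ s ≡ r ℤ.* (+ 2 ℤ.* x ℤ.+ + 0) ℤ.+ s
      index = solve-∀

    iterSum≈closedForm : ∀ n x → iterSum n c x summand ≈ closedForm n x
    iterSum≈closedForm zero    x = summand≈closedForm-0 x
    iterSum≈closedForm (suc n) x = begin
      sumℤ c x (λ y → iterSum n c y summand)                  ≈⟨ sumℤ-cong c x (iterSum≈closedForm n) ⟩
      sumℤ c x (closedForm n)                                 ≈⟨ sumℤ-telescope (λ y → sym (closedForm-difference n y)) c x ⟩
      closedForm (suc n) x - closedForm (suc n) (c ℤ.- + 1)   ≈⟨ +-congˡ (-‿cong (closedForm-at-pred n)) ⟩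
      closedForm (suc n) x - 0#                               ≈⟨ +-congˡ -0#≈0# ⟩
      closedForm (suc n) x + 0#                               ≈⟨ +-identityʳ _ ⟩
      closedForm (suc n) x                                    ∎

theorem4 : ∀ {ℓ₁ ℓ₂} (F : Field ℓ₁ ℓ₂) →
  let open Field F
      open FieldOps F
  in (a b p q : Carrier) (pnz : ¬ (p ≈ 0#)) (qnz : ¬ (q ≈ 0#))
     (r s c aₙ : ℤ) (Vnz : ¬ (V p q qnz r ≈ 0#)) (n : ℕ) → 1 ≤ n →
     iterSum n c aₙ
       (λ a₀ → sign a₀ * W a b p q qnz (+ 2 ℤ.* r ℤ.* a₀ ℤ.+ s)
                 * powℤ q qnz (ℤ.- (r ℤ.* a₀)))
     ≈ (sign aₙ * W a b p q qnz (r ℤ.* (+ 2 ℤ.* aₙ ℤ.+ + n) ℤ.+ s)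
          * powℤ q qnz (ℤ.- (r ℤ.* aₙ))
          * powℕ (inv (V p q qnz r) Vnz) n)
       + (sign c * powℤ q qnz (ℤ.- (r ℤ.* (c ℤ.- + 1)))
          * sumℕ n (λ j →
              W a b p q qnz
                (r ℤ.* (+ n ℤ.- + j ℤ.+ + 2 ℤ.* c ℤ.- + 2) ℤ.+ s)
              * powℕ (inv (V p q qnz r) Vnz) (n ℕ.∸ j)
              * fromℤ (binomℤ (aₙ ℤ.+ + j ℤ.- c) j)))
theorem4 F a b p q _ qnz r s c aₙ Vnz n _ = iterSum≈closedForm F a b p q qnz r s c Vnz n aₙ
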